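{- Let $S\subset[0,1]^2$ be finite with $(0,0)\in S$, and let $t_1,\dots,t_n$ be its tiles. For every $i=1,\dots,n$, the interior of the triangle $\Delta_i$ and the interior of the triangle $\Gamma_i$ are disjoint from $S$.
   Context: Order $S$ as $s_1,\dots,s_n$ so that $x(s_j)+y(s_j)\le x(s_i)+y(s_i)$ for $i<j$ (ties arbitrary). With $p\preceq q$ meaning both coordinates of $p$ are at most those of $q$, the tiles are $t_i=\{p\in[0,1]^2: s_i\preceq p,\ s_j\not\preceq p\ \forall j<i\}$; $t_i$ is a staircase polygon with lower left corner $s_i$, horizontal lower side $a_i$ and vertical left side $b_i$. $\Delta_i$ is the isosceles right triangle lying below $a_i$, bounded by $a_i$, the line of slope $-1$ through $s_i$, and the vertical line through the right endpoint of $a_i$. $\Gamma_i$ is the isosceles right triangle lying to the left of $b_i$, bounded by $b_i$, the line of slope $-1$ through $s_i$, and the horizontal line through the upper endpoint of $b_i$. -}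

module Defs where

open import Level using (0ℓ)
open import Data.Product using (Σ; ∃; _×_; _,_; proj₁; proj₂)
open import Data.Sum using (_⊎_)
open import Data.Nat using (ℕ)
open import Data.Fin using (Fin) renaming (_<_ to _<ᶠ_)
open import Relation.Nullary using (¬_)
open import Relation.Binary.PropositionalEquality using (_≡_; _≢_)
open import Relation.Binary.Structures using (IsStrictTotalOrder)
open import Algebra.Structures using (IsCommutativeRing)

-- The real numbers, axiomatised as a complete ordered field
-- (this characterises ℝ up to isomorphism).
record RealField : Set₁ where
  infixl 6 _+_
  infixl 7 _*_
  infix 4 _<_ _≤_
  field
    R     : Set
    0r 1r : R
    _+_ _*_ : R → R → R
    -_    : R → R
    _<_   : R → R → Set
    isCommutativeRing : IsCommutativeRing _≡_ _+_ _*_ -_ 0r 1r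
    isStrictTotalOrder : IsStrictTotalOrder _≡_ _<_
    0<1   : 0r < 1r
    inverse : ∀ x → x ≢ 0r → ∃ λ y → x * y ≡ 1r
    +-mono-< : ∀ {a b} c → a < b → a + c < b + c
    *-pos : ∀ {a b} → 0r < a → 0r < b → 0r < a * b

  _≤_ : R → R → Set
  x ≤ y = x < y ⊎ x ≡ y

  IsUpperBound : (R → Set) → R → Set
  IsUpperBound P u = ∀ x → P x → x ≤ u

  IsLUB : (R → Set) → R → Set
  IsLUB P s = IsUpperBound P s × (∀ u → IsUpperBound P u → s ≤ u)

  field
    complete : (P : R → Set) → ∃ P → ∃ (IsUpperBound P) → ∃ (IsLUB P)

module Geometry (ℝ : RealField) where
  open RealField ℝ

  Point : Set
  Point = R × R

  x : Point → R
  x = proj₁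

  y : Point → R
  y = proj₂

  InUnitSquare : Point → Set
  InUnitSquare p = (0r ≤ x p × x p ≤ 1r) × (0r ≤ y p × y p ≤ 1r)

  _⪯_ : Point → Point → Set
  p ⪯ q = x p ≤ x q × y p ≤ y q

  SortedBySum : ∀ {n} → (Fin n → Point) → Set
  SortedBySum {n} s = ∀ (i j : Fin n) → i <ᶠ j → x (s j) + y (s j) ≤ x (s i) + y (s i)

  InTile : ∀ {n} → (Fin n → Point) → Fin n → Point → Set
  InTile s i p = InUnitSquare p × s i ⪯ p × (∀ j → j <ᶠ i → ¬ (s j ⪯ p))

  -- the points of the lower side a_i lying in t_i (a_i minus its right endpoint)
  OnLowerSide : ∀ {n} → (Fin n → Point) → Fin n → Point → Set
  OnLowerSide s i q = InTile s i q × y q ≡ y (s i)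

  -- the points of the left side b_i lying in t_i (b_i minus its upper endpoint)
  OnLeftSide : ∀ {n} → (Fin n → Point) → Fin n → Point → Set
  OnLeftSide s i q = InTile s i q × x q ≡ x (s i)

  -- interior of Δ_i: strictly below a_i, strictly above the slope -1 line
  -- through s_i, strictly left of the vertical line through the right
  -- endpoint of a_i (i.e. its vertical projection lies on a_i before the
  -- right endpoint).
  InInteriorΔ : ∀ {n} → (Fin n → Point) → Fin n → Point → Set
  InInteriorΔ s i p =
    y p < y (s i) × x (s i) + y (s i) < x p + y p × OnLowerSide s i (x p , y (s i))

  -- interior of Γ_i: symmetric, to the left of b_i.
  InInteriorΓ : ∀ {n} → (Fin n → Point) → Fin n → Point → Set
  InInteriorΓ s i p =
    x p < x (s i) × x (s i) + y (s i) < x p + y p × OnLeftSide s i (x (s i) , y p)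

-- Hypotheses on the enumeration s_1,…,s_n of the finite set S ⊂ [0,1]²
-- (S is the image of the injective map s), with (0,0) ∈ S.
module _ (ℝ : RealField) where
  open RealField ℝ
  open Geometry ℝ

  record Enumeration (n : ℕ) (s : Fin n → Point) : Set where
    field
      injective   : ∀ {i j} → s i ≡ s j → i ≡ j
      inSquare    : ∀ k → InUnitSquare (s k)
      origin∈S    : ∃ λ k → s k ≡ (0r , 0r)
      sorted      : SortedBySum s

  InteriorsAvoidS : ∀ {n} → (Fin n → Point) → Set
  InteriorsAvoidS {n} s = ∀ (i k : Fin n) → ¬ InInteriorΔ s i (s k) × ¬ InInteriorΓ s i (s k)

-- A point s_k in the interior of Δ_i (or Γ_i) lies strictly above the
-- slope −1 line through s_i, so it precedes s_i in the enumeration.  But s_k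
-- is also ⪯ its vertical (horizontal) projection onto a_i (b_i), a point of
-- the tile t_i, and no earlier point of S is ⪯ a point of t_i.
module Submission where

open import Defs
open import Data.Nat using (ℕ)
open import Data.Fin using (Fin) renaming (_<_ to _<ᶠ_)
open import Data.Fin.Properties using (<-cmp)
open import Data.Product using (_,_)
open import Data.Sum using (inj₁; inj₂)
open import Data.Empty using (⊥-elim)
open import Relation.Nullary using (¬_)
open import Relation.Binary.Definitions using (tri<; tri≈; tri>)
open import Relation.Binary.PropositionalEquality using (refl)
open import Relation.Binary.Structures using (IsStrictTotalOrder)

module _ (ℝ : RealField) where
  open RealField ℝ
  open Geometry ℝ
  open IsStrictTotalOrder isStrictTotalOrder using (irrefl; trans)

  <⇒≱ : ∀ {a b} → a < b → ¬ (b ≤ a)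
  <⇒≱ a<b (inj₁ b<a) = irrefl refl (trans a<b b<a)
  <⇒≱ a<b (inj₂ refl) = irrefl refl a<b

  sum : Point → R
  sum p = x p + y p

  module _ {n} {s : Fin n → Point} (sorted : SortedBySum s) where

    larger-sum⇒earlier : ∀ i k → sum (s i) < sum (s k) → k <ᶠ i
    larger-sum⇒earlier i k lt with <-cmp k i
    ... | tri< k<i _ _ = k<i
    ... | tri≈ _ refl _ = ⊥-elim (irrefl refl lt)
    ... | tri> _ _ i<k = ⊥-elim (<⇒≱ lt (sorted i k i<k))

    tile-not-above-larger-sum : ∀ {i p} k → InTile s i p →
      sum (s i) < sum (s k) → ¬ (s k ⪯ p)
    tile-not-above-larger-sum {i} k (_ , _ , notAboveEarlier) lt =
      notAboveEarlier k (larger-sum⇒earlier i k lt)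

    ∉interiorΔ : ∀ i k → ¬ InInteriorΔ s i (s k)
    ∉interiorΔ i k (yk<yi , sum< , (inTile , _)) =
      tile-not-above-larger-sum k inTile sum< (inj₂ refl , inj₁ yk<yi)

    ∉interiorΓ : ∀ i k → ¬ InInteriorΓ s i (s k)
    ∉interiorΓ i k (xk<xi , sum< , (inTile , _)) =
      tile-not-above-larger-sum k inTile sum< (inj₁ xk<xi , inj₂ refl)

lemma4 : (ℝ : RealField) (n : ℕ) (s : Fin n → Geometry.Point ℝ) →
    Enumeration ℝ n s → InteriorsAvoidS ℝ s
lemma4 ℝ n s E i k = ∉interiorΔ ℝ sorted i k , ∉interiorΓ ℝ sorted i k
  where open Enumeration E using (sorted)
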